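{- If an implicative structure $\mathscr{A}=(\mathscr{A},\preccurlyeq,\to)$ is compatible with joins, then all its classical separators are filters (i.e. are closed under binary meets).
   Context: An implicative structure is a complete lattice $(\mathscr{A},\preccurlyeq)$ (meets $\bigwedge$, joins $\bigvee$) with $\to$ anti-monotonic in its first and monotonic in its second argument, commuting with arbitrary meets in its second argument. It is compatible with joins if $\bigwedge_{a\in A}(a\to b)=\bigl(\bigvee_{a\in A}a\bigr)\to b$ for all $A\subseteq\mathscr{A}$ and $b\in\mathscr{A}$. A separator is an upwards closed subset containing $\bigwedge_{a,b}(a\to b\to a)$ and $\bigwedge_{a,b,c}((a\to b\to c)\to(a\to b)\to a\to c)$ and closed under modus ponens; it is classical if it contains $\bigwedge_{a,b}(((a\to b)\to a)\to a)$. -}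

module Defs where

open import Level using (Level; _⊔_; suc)
open import Data.Product using (Σ; _×_; _,_; proj₁)
open import Relation.Binary.PropositionalEquality using (_≡_)

-- Meets and joins are taken of arbitrary families indexed by types in Set c
-- (a subset A ⊆ 𝒜 is the family proj₁ : Σ Carrier A → Carrier).
record ImplicativeStructure (c ℓ : Level) : Set (suc (c ⊔ ℓ)) where
  infixr 20 _⇒_
  infix 4 _≼_
  field
    Carrier : Set c
    _≼_     : Carrier → Carrier → Set ℓ
    ≼-refl  : ∀ {a} → a ≼ a
    ≼-trans : ∀ {a b d} → a ≼ b → b ≼ d → a ≼ d
    ≼-antisym : ∀ {a b} → a ≼ b → b ≼ a → a ≡ b
    ⋀ : {I : Set c} → (I → Carrier) → Carrier
    ⋀-lower    : {I : Set c} (f : I → Carrier) (i : I) → ⋀ f ≼ f i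
    ⋀-greatest : {I : Set c} (f : I → Carrier) (x : Carrier) →
                 (∀ i → x ≼ f i) → x ≼ ⋀ f
    ⋁ : {I : Set c} → (I → Carrier) → Carrier
    ⋁-upper : {I : Set c} (f : I → Carrier) (i : I) → f i ≼ ⋁ f
    ⋁-least : {I : Set c} (f : I → Carrier) (x : Carrier) →
              (∀ i → f i ≼ x) → ⋁ f ≼ x
    _⇒_ : Carrier → Carrier → Carrier
    ⇒-mono : ∀ {a a' b b'} → a' ≼ a → b ≼ b' → (a ⇒ b) ≼ (a' ⇒ b')
    ⇒-⋀ : (a : Carrier) {I : Set c} (f : I → Carrier) →
          (a ⇒ ⋀ f) ≡ ⋀ (λ i → a ⇒ f i)

  _∧_ : Carrier → Carrier → Carrier
  a ∧ b = ⋀ {I = Σ Carrier (λ x → (x ≡ a) Data.Sum.⊎ (x ≡ b))} proj₁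
    where import Data.Sum

  𝐤 : Carrier
  𝐤 = ⋀ {I = Carrier × Carrier} (λ { (a , b) → a ⇒ b ⇒ a })

  𝐬 : Carrier
  𝐬 = ⋀ {I = Carrier × Carrier × Carrier}
        (λ { (a , b , d) → (a ⇒ b ⇒ d) ⇒ (a ⇒ b) ⇒ a ⇒ d })

  𝐜𝐜 : Carrier
  𝐜𝐜 = ⋀ {I = Carrier × Carrier} (λ { (a , b) → ((a ⇒ b) ⇒ a) ⇒ a })

  CompatibleWithJoins : Set (suc c)
  CompatibleWithJoins =
    (A : Carrier → Set c) (b : Carrier) →
    ⋀ {I = Σ Carrier A} (λ x → proj₁ x ⇒ b) ≡ (⋁ {I = Σ Carrier A} proj₁ ⇒ b)

  record IsSeparator (S : Carrier → Set c) : Set (c ⊔ ℓ) where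
    field
      upward : ∀ {a b} → a ≼ b → S a → S b
      k∈S    : S 𝐤
      s∈S    : S 𝐬
      mp     : ∀ {a b} → S (a ⇒ b) → S a → S b

  record IsClassicalSeparator (S : Carrier → Set c) : Set (c ⊔ ℓ) where
    field
      isSeparator : IsSeparator S
      cc∈S        : S 𝐜𝐜

  ClosedUnderMeets : (S : Carrier → Set c) → Set c
  ClosedUnderMeets S = ∀ {a b} → S a → S b → S (a ∧ b)

module Submission where

-- Write ¬x = x ⇒ ⊥ and let S be a classical separator.  Peirce's
-- law gives 𝐜𝐜 ≼ ¬¬x ⇒ x, hence S(⋀ᵢ ¬¬fᵢ) implies S(⋀ᵢ fᵢ) for every family f
-- (combinators act "uniformly" on meets since ⇒ commutes with meets).  So for
-- a, b ∈ S it suffices to put the family  ¬¬a , ¬¬b  into S.  Index it by the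
-- two sides, set X = ⊤ on the a-side and X = ⊥ on the b-side, and apply 𝐬
-- uniformly:
--     ¬¬xᵢ  ⇐  (¬xᵢ ⇒ Xᵢ ⇒ ⊥)  and  (¬xᵢ ⇒ Xᵢ).
-- Both families are above a Church point ⋀_Y ((x ⇒ Y) ⇒ Y) with x ∈ {a, b},
-- which lies in S when x does.  The one non-trivial inequality,
-- ¬b ≼ a ⇒ ⊥ ⇒ ⊥, holds because compatibility with joins forces ⊥ ⇒ ⊥ = ⊤
-- (⊥ = ⋁∅, so ⊥ ⇒ y = ⋀∅ = ⊤); this is the only use of that hypothesis.

open import Level using (Level; Lift)
open import Defs
open import Data.Empty using (⊥)
open import Data.Sum using (_⊎_; inj₁; inj₂)
open import Data.Product using (Σ; _,_; proj₁)
open import Relation.Binary.PropositionalEquality using (_≡_; refl; sym)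

module Lattice {c ℓ : Level} (𝒜 : ImplicativeStructure c ℓ) where
  open ImplicativeStructure 𝒜

  ≡⇒≼ : ∀ {x y} → x ≡ y → x ≼ y
  ≡⇒≼ refl = ≼-refl

  ≼-⇒⋀ : ∀ {z a} {I : Set c} {f : I → Carrier} →
         (∀ i → z ≼ a ⇒ f i) → z ≼ a ⇒ ⋀ f
  ≼-⇒⋀ {z} {a} {f = f} h = ≼-trans (⋀-greatest _ z h) (≡⇒≼ (sym (⇒-⋀ a f)))

  ⋀-⇒ : {I : Set c} (p q : I → Carrier) →
        ⋀ (λ i → p i ⇒ q i) ≼ ⋀ p ⇒ ⋀ q
  ⋀-⇒ p q = ≼-⇒⋀ (λ i → ≼-trans (⋀-lower _ i) (⇒-mono (⋀-lower p i) ≼-refl))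

  ∅ : Carrier → Set c
  ∅ _ = Lift c ⊥

  ⊥ᴬ ⊤ᴬ : Carrier
  ⊥ᴬ = ⋁ {I = Σ Carrier ∅} proj₁
  ⊤ᴬ = ⋀ {I = Σ Carrier ∅} proj₁

  ⊥-least : ∀ x → ⊥ᴬ ≼ x
  ⊥-least x = ⋁-least _ x (λ ())

  ≼-⇒⊤ : ∀ {z a} → z ≼ a ⇒ ⊤ᴬ
  ≼-⇒⊤ = ≼-⇒⋀ (λ ())

  infixr 25 ¬_
  ¬_ : Carrier → Carrier
  ¬ x = x ⇒ ⊥ᴬ

  ≼-⊥⇒ : CompatibleWithJoins → ∀ {z y} → z ≼ ⊥ᴬ ⇒ y
  ≼-⊥⇒ compat {z} {y} = ≼-trans (⋀-greatest _ z (λ ())) (≡⇒≼ (compat ∅ y))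

module Separator {c ℓ : Level} (𝒜 : ImplicativeStructure c ℓ)
  (S : ImplicativeStructure.Carrier 𝒜 → Set c)
  (sep : ImplicativeStructure.IsSeparator 𝒜 S) where
  open ImplicativeStructure 𝒜
  open IsSeparator sep
  open Lattice 𝒜

  mp-⋀ : {I : Set c} {p q : I → Carrier} →
         S (⋀ (λ i → p i ⇒ q i)) → S (⋀ p) → S (⋀ q)
  mp-⋀ {p = p} {q} h x = mp (upward (⋀-⇒ p q) h) x

  k-⋀ : {I : Set c} (u v : I → Carrier) → S (⋀ (λ i → u i ⇒ v i ⇒ u i))
  k-⋀ u v = upward (⋀-greatest _ 𝐤 (λ i → ⋀-lower _ (u i , v i))) k∈S

  s-⋀ : {I : Set c} {u v w : I → Carrier} →
        S (⋀ (λ i → u i ⇒ v i ⇒ w i)) → S (⋀ (λ i → u i ⇒ v i)) →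
        S (⋀ (λ i → u i ⇒ w i))
  s-⋀ {u = u} {v} {w} f g = mp-⋀ (mp-⋀ s-instances f) g
    where
    s-instances : S (⋀ (λ i → (u i ⇒ v i ⇒ w i) ⇒ (u i ⇒ v i) ⇒ u i ⇒ w i))
    s-instances = upward (⋀-greatest _ 𝐬 (λ i → ⋀-lower _ (u i , v i , w i))) s∈S

  -- 𝐈 = ⋀ₓ (x ⇒ x) ∈ S, obtained as 𝐬𝐤𝐤.
  id∈S : S (⋀ {I = Carrier} (λ x → x ⇒ x))
  id∈S = s-⋀ (k-⋀ (λ x → x) (λ x → x ⇒ x)) (k-⋀ (λ x → x) (λ x → x))

  const∈S : ∀ {x} → S x → S (⋀ {I = Carrier} (λ w → w ⇒ x))
  const∈S {x} x∈S = mp (upward (≼-⇒⋀ (λ w → ⋀-lower _ (x , w))) k∈S) x∈S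

  point∈S : ∀ {x} → S x → S (⋀ {I = Carrier} (λ Y → (x ⇒ Y) ⇒ Y))
  point∈S {x} x∈S = s-⋀ identities constants
    where
    identities : S (⋀ {I = Carrier} (λ Y → (x ⇒ Y) ⇒ x ⇒ Y))
    identities = upward (⋀-greatest _ _ (λ Y → ⋀-lower _ (x ⇒ Y))) id∈S
    constants : S (⋀ {I = Carrier} (λ Y → (x ⇒ Y) ⇒ x))
    constants = upward (⋀-greatest _ _ (λ Y → ⋀-lower _ (x ⇒ Y))) (const∈S x∈S)

  ⋀⇒∈S : ∀ {x} {I : Set c} {u y : I → Carrier} → S x →
         (∀ i → u i ≼ x ⇒ y i) → S (⋀ (λ i → u i ⇒ y i))
  ⋀⇒∈S x∈S h = upward
    (⋀-greatest _ _ (λ i → ≼-trans (⋀-lower _ _) (⇒-mono (h i) ≼-refl)))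
    (point∈S x∈S)

module Classical {c ℓ : Level} (𝒜 : ImplicativeStructure c ℓ)
  (S : ImplicativeStructure.Carrier 𝒜 → Set c)
  (cl : ImplicativeStructure.IsClassicalSeparator 𝒜 S) where
  open ImplicativeStructure 𝒜
  open IsClassicalSeparator cl
  open IsSeparator isSeparator
  open Lattice 𝒜

  𝐜𝐜-¬¬ : ∀ x → 𝐜𝐜 ≼ ¬ ¬ x ⇒ x
  𝐜𝐜-¬¬ x = ≼-trans (⋀-lower _ (x , ⊥ᴬ))
                    (⇒-mono (⇒-mono ≼-refl (⊥-least x)) ≼-refl)

  ¬¬-elim-⋀ : {I : Set c} (f : I → Carrier) → S (⋀ (λ i → ¬ ¬ f i)) → S (⋀ f)
  ¬¬-elim-⋀ f h = mp (upward (≼-trans (⋀-greatest _ 𝐜𝐜 (λ i → 𝐜𝐜-¬¬ (f i)))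
                                       (⋀-⇒ (λ i → ¬ ¬ f i) f))
                             cc∈S)
                     h

proposition3p33 : {c ℓ : Level} (𝒜 : ImplicativeStructure c ℓ) →
    ImplicativeStructure.CompatibleWithJoins 𝒜 →
    (S : ImplicativeStructure.Carrier 𝒜 → Set c) →
    ImplicativeStructure.IsClassicalSeparator 𝒜 S →
    ImplicativeStructure.ClosedUnderMeets 𝒜 S
proposition3p33 𝒜 compat S cl {a} {b} a∈S b∈S =
  ¬¬-elim-⋀ proj₁ (s-⋀ (⋀⇒∈S a∈S below-a) (⋀⇒∈S b∈S below-b))
  where
  open ImplicativeStructure 𝒜
  open Lattice 𝒜
  open Separator 𝒜 S (IsClassicalSeparator.isSeparator cl)
  open Classical 𝒜 S cl

  -- a ∧ b is the meet of proj₁ over this index set, one point for each side.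
  Side : Set _
  Side = Σ Carrier (λ x → (x ≡ a) ⊎ (x ≡ b))

  X : Side → Carrier
  X (_ , inj₁ _) = ⊤ᴬ
  X (_ , inj₂ _) = ⊥ᴬ

  below-a : ∀ i → ¬ proj₁ i ≼ a ⇒ X i ⇒ ⊥ᴬ
  below-a (_ , inj₁ refl) = ⇒-mono ≼-refl (⊥-least _)
  below-a (_ , inj₂ refl) = ≼-trans ≼-⇒⊤ (⇒-mono ≼-refl (≼-⊥⇒ compat))

  below-b : ∀ i → ¬ proj₁ i ≼ b ⇒ X i
  below-b (_ , inj₁ refl) = ≼-⇒⊤
  below-b (_ , inj₂ refl) = ≼-refl
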